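{- Let $l$ be a positive integer. Define the sequence $(m_i)_{i\ge 0}$ of non-negative integers by $$ m_i := \begin{cases} 2^{i+1}, & 0\le i\le 2l-2,\\ 2^{2l}-1, & i=2l-1,\\ 2^{i+1}-2^{i-2l}, & i\ge 2l. \end{cases} $$ Let $A_0:=\{0\}$, $B_0:=\{1\}$, and for $i=1,2,\dots$ define recursively $$ A_i := A_{i-1}\cup (m_{i-1}+B_{i-1}), \qquad B_i := B_{i-1}\cup (m_{i-1}+A_{i-1}). $$ Let $A:=\bigcup_{i\ge 0}A_i$ and $B:=\bigcup_{i\ge 0}B_i$. Then $R_A=R_B$, $A\cup B=\mathbb{N}_0$, and $A\cap B=(2^{2l}-1)+(2^{2l+1}-1)\mathbb{N}_0$.
   Context: $\mathbb{N}_0$ denotes the set of non-negative integers. For $A\subseteq\mathbb{N}_0$, the representation function $R_A$ is defined for each integer $n$ by $R_A(n):=|\{(a',a'')\in A\times A : n=a'+a'',\ a'<a''\}|$, i.e. the number of unordered representations of $n$ as a sum of two distinct elements of $A$. For an integer $m$ and a set $X$ of integers, $m+X:=\{m+x : x\in X\}$ and $kX:=\{kx: x\in X\}$; thus $r+k\mathbb{N}_0=\{r,r+k,r+2k,\dots\}$. -}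

module Defs where

open import Data.Nat using (ℕ; zero; suc; _+_; _*_; _∸_; _^_; _<_; _≟_; _<?_)
open import Data.List using (List; []; _∷_; _++_; map; length)
open import Data.List.Membership.Propositional using (_∈_)
open import Data.List.Relation.Unary.Unique.Propositional using (Unique)
open import Data.Product using (Σ; ∃; _×_; _,_)
open import Relation.Nullary using (yes; no)
open import Relation.Binary.PropositionalEquality using (_≡_)
open import Function.Bundles using (_⇔_)

m : ℕ → ℕ → ℕ
m l i with suc i <? 2 * l
... | yes _ = 2 ^ suc i
... | no _ with suc i ≟ 2 * l
...   | yes _ = 2 ^ (2 * l) ∸ 1
...   | no _  = 2 ^ suc i ∸ 2 ^ (i ∸ 2 * l)

-- The finite sets A_i, B_i, represented as lists (union = concatenation).
AB : ℕ → ℕ → List ℕ × List ℕ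
AB l zero = (0 ∷ []) , (1 ∷ [])
AB l (suc i) with AB l i
... | (Ai , Bi) = (Ai ++ map (m l i +_) Bi) , (Bi ++ map (m l i +_) Ai)

Aₛ : ℕ → ℕ → List ℕ
Aₛ l i = Data.Product.proj₁ (AB l i)

Bₛ : ℕ → ℕ → List ℕ
Bₛ l i = Data.Product.proj₂ (AB l i)

InA : ℕ → ℕ → Set
InA l n = ∃ λ i → n ∈ Aₛ l i

InB : ℕ → ℕ → Set
InB l n = ∃ λ i → n ∈ Bₛ l i

Rep : (ℕ → Set) → ℕ → ℕ × ℕ → Set
Rep X n (a₁ , a₂) = X a₁ × X a₂ × (a₁ + a₂ ≡ n) × (a₁ < a₂)

HasCard : (ℕ × ℕ → Set) → ℕ → Set
HasCard P k = Σ (List (ℕ × ℕ)) λ xs →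
  Unique xs × (∀ p → (p ∈ xs) ⇔ P p) × (length xs ≡ k)

R≡ : (ℕ → Set) → ℕ → ℕ → Set
R≡ X n k = HasCard (Rep X n) k

module Submission where

-- Proof outline.  Write A_i, B_i for the stages, and M_i := 1 + m_0 + ... + m_(i-1).
--
-- For a weight g : ℕ → ℕ let P_g(X) := Σ_{x<y in X} g(x + y); for g the
--     indicator of n this is R_X(n).  If P_g(X) = P_g(Y) for every g and the unions
--     X ∪ (d + Y), Y ∪ (d + X) are disjoint, then the same holds for these unions, since
--     P_g(X ∪ (d + Y)) = P_g(X) + Σ_{x∈X, y∈Y} g(x + d + y) + P_{g(2d + ·)}(Y)
--     for a shift d.
--     Hence P_g(A_i) = P_g(B_i) for all i and g.
-- (2) Arithmetic.  With p = 2^(2l) - 1 and q = 2^(2l+1) - 1 = 2p + 1 one has M_i = 2^(i+1) - 1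
--     for i < 2l and M_(2l+j) = 2^j q - 1, so m_i = M_i + 1 except at the critical index
--     i = 2l - 1, where m_i = M_i = p; beyond it every m_i is a multiple of q.
-- (3) Structure.  By induction on i: A_i ∪ B_i = [0, M_i], the unions in the recursion are
--     disjoint (so the stages have no repetitions), and A_i ∩ B_i consists of the numbers
--     p + tq ≤ M_i when i ≥ 2l and is empty before.  Below M_i the sets A, B agree with A_i, B_i.
-- (4) The theorem: R_A(n), R_B(n) are read off the stages A_n, B_n and agree by (1); covering
--     and the intersection follow from (3).

open import Data.Nat using (ℕ; zero; suc; _+_; _*_; _∸_; _^_; _<_; _≤_; z≤n; s≤s; _<ᵇ_; _≡ᵇ_)
open import Data.Nat.Properties
open import Data.Nat.Tactic.RingSolver using (solve-∀)
open import Data.Bool using (Bool; true; false; not; if_then_else_; T)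
open import Data.Unit using (tt)
open import Data.Empty using (⊥; ⊥-elim)
open import Data.List using (List; []; _∷_; _++_; map; length; filter; cartesianProduct)
open import Data.List.Properties using (length-++; filter-++)
open import Data.List.Membership.Propositional using (_∈_)
open import Data.List.Membership.Propositional.Properties
  using (∈-++⁺ˡ; ∈-++⁺ʳ; ∈-++⁻; ∈-map⁺; ∈-map⁻; ∈-filter⁺; ∈-filter⁻; ∈-cartesianProduct⁺; ∈-cartesianProduct⁻)
open import Data.List.Relation.Unary.Any using (here; there)
open import Data.List.Relation.Unary.AllPairs using ([]; _∷_)
open import Data.List.Relation.Unary.All using ([])
open import Data.List.Relation.Unary.Unique.Propositional using (Unique)
import Data.List.Relation.Unary.Unique.Propositional.Properties as Unique
open import Data.Product using (∃; _×_; _,_; proj₁; proj₂)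
import Data.Product
open import Data.Sum using (_⊎_; inj₁; inj₂)
import Data.Sum
open import Relation.Nullary using (¬_; Dec; yes; no)
open import Relation.Nullary.Decidable using (_×-dec_)
open import Relation.Binary using (tri<; tri≈; tri>)
open import Relation.Binary.PropositionalEquality
open import Function.Bundles using (_⇔_; mk⇔)
open import Defs

private variable
  A B C D : Set

∑ : List A → (A → ℕ) → ℕ
∑ []       f = 0
∑ (x ∷ xs) f = f x + ∑ xs f

syntax ∑ xs (λ x → e) = ∑[ x ∈ xs ] e

∑-++ : ∀ (xs ys : List A) f → ∑ (xs ++ ys) f ≡ ∑ xs f + ∑ ys f
∑-++ []       ys f = refl
∑-++ (x ∷ xs) ys f = trans (cong (f x +_) (∑-++ xs ys f)) (sym (+-assoc (f x) _ _))

∑-map : ∀ (g : A → B) xs f → ∑ (map g xs) f ≡ ∑[ x ∈ xs ] f (g x)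
∑-map g []       f = refl
∑-map g (x ∷ xs) f = cong (f (g x) +_) (∑-map g xs f)

∑-cong : ∀ (xs : List A) {f g} → (∀ x → x ∈ xs → f x ≡ g x) → ∑ xs f ≡ ∑ xs g
∑-cong []       eq = refl
∑-cong (x ∷ xs) eq = cong₂ _+_ (eq x (here refl)) (∑-cong xs (λ y y∈ → eq y (there y∈)))

∑-+ : ∀ (xs : List A) f g → ∑[ x ∈ xs ] (f x + g x) ≡ ∑ xs f + ∑ xs g
∑-+ []       f g = refl
∑-+ (x ∷ xs) f g = trans (cong (f x + g x +_) (∑-+ xs f g)) (interchange (f x) (g x) _ _)
  where
  interchange : ∀ a b c d → (a + b) + (c + d) ≡ (a + c) + (b + d)
  interchange = solve-∀

∑-zero : ∀ (xs : List A) → ∑[ x ∈ xs ] 0 ≡ 0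
∑-zero []       = refl
∑-zero (x ∷ xs) = ∑-zero xs

∑-comm : ∀ (xs : List A) (ys : List B) (f : A → B → ℕ) →
  ∑[ x ∈ xs ] ∑[ y ∈ ys ] f x y ≡ ∑[ y ∈ ys ] ∑[ x ∈ xs ] f x y
∑-comm []       ys f = sym (∑-zero ys)
∑-comm (x ∷ xs) ys f = trans (cong (∑ ys (f x) +_) (∑-comm xs ys f))
                              (sym (∑-+ ys (f x) (λ y → ∑[ x′ ∈ xs ] f x′ y)))

∑∑-+ : ∀ (xs : List A) (ys : List B) (f g : A → B → ℕ) →
  ∑[ x ∈ xs ] ∑[ y ∈ ys ] (f x y + g x y)
    ≡ ∑[ x ∈ xs ] ∑[ y ∈ ys ] f x y + ∑[ x ∈ xs ] ∑[ y ∈ ys ] g x y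
∑∑-+ xs ys f g = trans (∑-cong xs (λ x _ → ∑-+ ys (f x) (g x))) (∑-+ xs _ _)

∑∑-cong : ∀ (xs : List A) (ys : List B) {f g : A → B → ℕ} →
  (∀ x → x ∈ xs → ∀ y → y ∈ ys → f x y ≡ g x y) →
  ∑[ x ∈ xs ] ∑[ y ∈ ys ] f x y ≡ ∑[ x ∈ xs ] ∑[ y ∈ ys ] g x y
∑∑-cong xs ys eq = ∑-cong xs (λ x x∈ → ∑-cong ys (eq x x∈))

∑∑-map : ∀ (h : A → C) (k : B → D) xs ys (f : C → D → ℕ) →
  ∑[ x ∈ map h xs ] ∑[ y ∈ map k ys ] f x y ≡ ∑[ x ∈ xs ] ∑[ y ∈ ys ] f (h x) (k y)
∑∑-map h k xs ys f = trans (∑-map h xs _) (∑-cong xs (λ x _ → ∑-map k ys (f (h x))))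

∑∑-++ : ∀ (xs ys : List A) (f : A → A → ℕ) →
  ∑[ x ∈ xs ++ ys ] ∑[ y ∈ xs ++ ys ] f x y
    ≡ (∑[ x ∈ xs ] ∑[ y ∈ xs ] f x y + ∑[ x ∈ xs ] ∑[ y ∈ ys ] f x y)
    + (∑[ x ∈ ys ] ∑[ y ∈ xs ] f x y + ∑[ x ∈ ys ] ∑[ y ∈ ys ] f x y)
∑∑-++ xs ys f = trans (∑-++ xs ys _) (cong₂ _+_ (columns xs) (columns ys))
  where
  columns : ∀ zs → ∑[ x ∈ zs ] ∑ (xs ++ ys) (f x)
                 ≡ ∑[ x ∈ zs ] ∑[ y ∈ xs ] f x y + ∑[ x ∈ zs ] ∑[ y ∈ ys ] f x y
  columns zs = trans (∑-cong zs (λ x _ → ∑-++ xs ys (f x))) (∑-+ zs _ _)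

χ< : ℕ → ℕ → ℕ
χ< x y = if x <ᵇ y then 1 else 0

χ<-shift : ∀ d x y → χ< (d + x) (d + y) ≡ χ< x y
χ<-shift zero    x y = refl
χ<-shift (suc d) x y = χ<-shift d x y

χ<-yes : ∀ {x y} → x < y → χ< x y ≡ 1
χ<-yes {x} {y} x<y with x <ᵇ y | <⇒<ᵇ x<y
... | true | _ = refl

χ<-no : ∀ {x y} → y ≤ x → χ< x y ≡ 0
χ<-no {x} {y} y≤x with x <ᵇ y in eq
... | false = refl
... | true  = ⊥-elim (<⇒≱ (<ᵇ⇒< x y (subst T (sym eq) tt)) y≤x)

χ<-distinct : ∀ {x y} → x ≢ y → χ< x y + χ< y x ≡ 1
χ<-distinct {x} {y} x≢y with <-cmp x y
... | tri< x<y _ _ = cong₂ _+_ (χ<-yes x<y) (χ<-no (<⇒≤ x<y))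
... | tri≈ _ x≡y _ = ⊥-elim (x≢y x≡y)
... | tri> _ _ y<x = cong₂ _+_ (χ<-no (<⇒≤ y<x)) (χ<-yes y<x)

weight : (ℕ → ℕ) → ℕ → ℕ → ℕ
weight g x y = g (x + y) * χ< x y

weight-distinct : ∀ g {x y} → x ≢ y → weight g x y + weight g y x ≡ g (x + y)
weight-distinct g {x} {y} x≢y = begin
  g (x + y) * χ< x y + g (y + x) * χ< y x ≡⟨ cong (λ s → g (x + y) * χ< x y + g s * χ< y x) (+-comm y x) ⟩
  g (x + y) * χ< x y + g (x + y) * χ< y x ≡⟨ sym (*-distribˡ-+ (g (x + y)) (χ< x y) (χ< y x)) ⟩
  g (x + y) * (χ< x y + χ< y x)           ≡⟨ cong (g (x + y) *_) (χ<-distinct x≢y) ⟩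
  g (x + y) * 1                           ≡⟨ *-identityʳ (g (x + y)) ⟩
  g (x + y)                               ∎
  where open ≡-Reasoning

pairSum : (ℕ → ℕ) → List ℕ → ℕ
pairSum g X = ∑[ x ∈ X ] ∑[ y ∈ X ] weight g x y

SameRep : List ℕ → List ℕ → Set
SameRep X Y = ∀ g → pairSum g X ≡ pairSum g Y

Separated : ℕ → List ℕ → List ℕ → Set
Separated d X Y = ∀ x → x ∈ X → ∀ y → y ∈ Y → x ≢ d + y

crossSum : (ℕ → ℕ) → ℕ → List ℕ → List ℕ → ℕ
crossSum g d X Y = ∑[ x ∈ X ] ∑[ y ∈ Y ] g (x + (d + y))

crossSum-sym : ∀ g d X Y → crossSum g d X Y ≡ crossSum g d Y X
crossSum-sym g d X Y =
  trans (∑-comm X Y _) (∑∑-cong Y X (λ y _ x _ → cong g (rearrange d x y)))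
  where
  rearrange : ∀ d x y → x + (d + y) ≡ y + (d + x)
  rearrange = solve-∀

pairSum-union : ∀ g d X Y → Separated d X Y →
  pairSum g (X ++ map (d +_) Y) ≡ pairSum g X + crossSum g d X Y + pairSum (λ s → g (d + d + s)) Y
pairSum-union g d X Y sep = begin
  pairSum g (X ++ Z)
    ≡⟨ ∑∑-++ X Z (weight g) ⟩
  (pairSum g X + ∑[ x ∈ X ] ∑[ z ∈ Z ] w x z) + (∑[ z ∈ Z ] ∑[ x ∈ X ] w z x + pairSum g Z)
    ≡⟨ regroup (pairSum g X) _ _ _ ⟩
  pairSum g X + (∑[ x ∈ X ] ∑[ z ∈ Z ] w x z + ∑[ z ∈ Z ] ∑[ x ∈ X ] w z x) + pairSum g Z
    ≡⟨ cong₂ (λ u v → pairSum g X + u + v) across within ⟩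
  pairSum g X + crossSum g d X Y + pairSum (λ s → g (d + d + s)) Y ∎
  where
  open ≡-Reasoning
  Z : List ℕ
  Z = map (d +_) Y
  w : ℕ → ℕ → ℕ
  w = weight g
  regroup : ∀ a b c e → (a + b) + (c + e) ≡ a + (b + c) + e
  regroup = solve-∀
  across : ∑[ x ∈ X ] ∑[ z ∈ Z ] w x z + ∑[ z ∈ Z ] ∑[ x ∈ X ] w z x ≡ crossSum g d X Y
  across = begin
    ∑[ x ∈ X ] ∑[ z ∈ Z ] w x z + ∑[ z ∈ Z ] ∑[ x ∈ X ] w z x
      ≡⟨ cong (∑[ x ∈ X ] ∑[ z ∈ Z ] w x z +_) (∑-comm Z X (λ z x → w z x)) ⟩
    ∑[ x ∈ X ] ∑[ z ∈ Z ] w x z + ∑[ x ∈ X ] ∑[ z ∈ Z ] w z x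
      ≡⟨ sym (∑∑-+ X Z w (λ x z → w z x)) ⟩
    ∑[ x ∈ X ] ∑[ z ∈ Z ] (w x z + w z x)
      ≡⟨ ∑-cong X (λ x _ → ∑-map (d +_) Y _) ⟩
    ∑[ x ∈ X ] ∑[ y ∈ Y ] (w x (d + y) + w (d + y) x)
      ≡⟨ ∑∑-cong X Y (λ x x∈ y y∈ → weight-distinct g (sep x x∈ y y∈)) ⟩
    crossSum g d X Y ∎
  within : pairSum g Z ≡ pairSum (λ s → g (d + d + s)) Y
  within = trans (∑∑-map (d +_) (d +_) Y Y w)
    (∑∑-cong Y Y (λ x _ y _ → cong₂ _*_ (cong g (shift d x y)) (χ<-shift d x y)))
    where
    shift : ∀ d x y → d + x + (d + y) ≡ d + d + (x + y)
    shift = solve-∀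

sameRep-step : ∀ d X Y → Separated d X Y → Separated d Y X → SameRep X Y →
  SameRep (X ++ map (d +_) Y) (Y ++ map (d +_) X)
sameRep-step d X Y sepXY sepYX same g = begin
  pairSum g (X ++ map (d +_) Y)                ≡⟨ pairSum-union g d X Y sepXY ⟩
  pairSum g X + crossSum g d X Y + pairSum g′ Y ≡⟨ cong₂ (λ a b → a + crossSum g d X Y + b) (same g) (sym (same g′)) ⟩
  pairSum g Y + crossSum g d X Y + pairSum g′ X ≡⟨ cong (λ c → pairSum g Y + c + pairSum g′ X) (crossSum-sym g d X Y) ⟩
  pairSum g Y + crossSum g d Y X + pairSum g′ X ≡⟨ sym (pairSum-union g d Y X sepYX) ⟩
  pairSum g (Y ++ map (d +_) X)                ∎
  where
  open ≡-Reasoning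
  g′ : ℕ → ℕ
  g′ s = g (d + d + s)

δ : ℕ → ℕ → ℕ
δ n s = if s ≡ᵇ n then 1 else 0

IsRep? : ∀ n (pr : ℕ × ℕ) → Dec ((proj₁ pr + proj₂ pr ≡ n) × (proj₁ pr < proj₂ pr))
IsRep? n (x , y) = (x + y ≟ n) ×-dec (x <? y)

reps : ℕ → List ℕ → List (ℕ × ℕ)
reps n L = filter (IsRep? n) (cartesianProduct L L)

length-reps : ∀ n xs ys →
  length (filter (IsRep? n) (cartesianProduct xs ys)) ≡ ∑[ x ∈ xs ] ∑[ y ∈ ys ] weight (δ n) x y
length-reps n []       ys = refl
length-reps n (x ∷ xs) ys = begin
  length (filter (IsRep? n) (map (x ,_) ys ++ cartesianProduct xs ys))
    ≡⟨ cong length (filter-++ (IsRep? n) (map (x ,_) ys) (cartesianProduct xs ys)) ⟩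
  length (filter (IsRep? n) (map (x ,_) ys) ++ filter (IsRep? n) (cartesianProduct xs ys))
    ≡⟨ length-++ (filter (IsRep? n) (map (x ,_) ys)) ⟩
  length (filter (IsRep? n) (map (x ,_) ys)) + length (filter (IsRep? n) (cartesianProduct xs ys))
    ≡⟨ cong₂ _+_ (row ys) (length-reps n xs ys) ⟩
  ∑[ x′ ∈ x ∷ xs ] ∑[ y ∈ ys ] weight (δ n) x′ y ∎
  where
  open ≡-Reasoning
  row : ∀ zs → length (filter (IsRep? n) (map (x ,_) zs)) ≡ ∑[ y ∈ zs ] weight (δ n) x y
  row []       = refl
  row (y ∷ zs) with x + y ≡ᵇ n | x <ᵇ y
  ... | true  | true  = cong suc (row zs)
  ... | true  | false = row zs
  ... | false | true  = row zs
  ... | false | false = row zs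

R≡-list : ∀ (X : ℕ → Set) n L → Unique L →
  (∀ a → a ∈ L → X a) → (∀ a → a ≤ n → X a → a ∈ L) → R≡ X n (pairSum (δ n) L)
R≡-list X n L unique listed window =
  reps n L , Unique.filter⁺ (IsRep? n) (Unique.cartesianProduct⁺ unique unique) , members , length-reps n L L
  where
  members : ∀ pr → (pr ∈ reps n L) ⇔ Rep X n pr
  members (a , b) = mk⇔ to from
    where
    to : (a , b) ∈ reps n L → Rep X n (a , b)
    to h with ∈-filter⁻ (IsRep? n) h
    ... | ab∈ , sum≡ , a<b with ∈-cartesianProduct⁻ L L ab∈
    ...   | a∈ , b∈ = listed a a∈ , listed b b∈ , sum≡ , a<b
    from : Rep X n (a , b) → (a , b) ∈ reps n L
    from (Xa , Xb , sum≡ , a<b) = ∈-filter⁺ (IsRep? n)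
      (∈-cartesianProduct⁺ (window a (subst (a ≤_) sum≡ (m≤m+n a b)) Xa)
                           (window b (subst (b ≤_) sum≡ (m≤n+m b a)) Xb))
      (sum≡ , a<b)

-- M l i = 1 + m_0 + … + m_{i-1}; it turns out to be the largest element of A_i ∪ B_i.
M : ℕ → ℕ → ℕ
M l zero    = 1
M l (suc i) = m l i + M l i

M-step : ∀ l i → M l i ≤ M l (suc i)
M-step l i = m≤n+m (M l i) (m l i)

p q : ℕ → ℕ
p l = 2 ^ (2 * l) ∸ 1
q l = 2 ^ suc (2 * l) ∸ 1

M-mono : ∀ l {i} j → i ≤ j → M l i ≤ M l j
M-mono l zero    z≤n = ≤-refl
M-mono l (suc j) le with m≤n⇒m<n∨m≡n le
... | inj₁ (s≤s i≤j) = ≤-trans (M-mono l j i≤j) (M-step l j)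
... | inj₂ refl      = ≤-refl

2^2l≡1+p : ∀ l → 2 ^ (2 * l) ≡ suc (p l)
2^2l≡1+p l = sym (m+[n∸m]≡n (m^n>0 2 (2 * l)))

q≡1+2p : ∀ l → q l ≡ suc (p l + p l)
q≡1+2p l = cong (_∸ 1) (trans (cong (2 *_) (2^2l≡1+p l)) (double (p l)))
  where
  double : ∀ x → 2 * suc x ≡ suc (suc (x + x))
  double = solve-∀

p<q : ∀ l → p l < q l
p<q l = subst (p l <_) (sym (q≡1+2p l)) (s≤s (m≤m+n (p l) (p l)))

m-below : ∀ l i → suc i < 2 * l → m l i ≡ 2 ^ suc i
m-below l i below with suc i <? 2 * l
... | yes _     = refl
... | no ¬below = ⊥-elim (¬below below)

m-at : ∀ l i → suc i ≡ 2 * l → m l i ≡ p l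
m-at l i at with suc i <? 2 * l
... | yes below = ⊥-elim (<-irrefl at below)
... | no _ with suc i ≟ 2 * l
...   | yes _   = refl
...   | no ¬at  = ⊥-elim (¬at at)

m-beyond : ∀ l j → m l (2 * l + j) ≡ 2 ^ j * q l
m-beyond l j with suc (2 * l + j) <? 2 * l
... | yes below = ⊥-elim (<⇒≱ below (m≤n⇒m≤1+n (m≤m+n (2 * l) j)))
... | no _ with suc (2 * l + j) ≟ 2 * l
...   | yes at = ⊥-elim (m+1+n≰m (2 * l) (≤-reflexive (trans (+-suc (2 * l) j) at)))
...   | no _ = begin
  2 ^ suc (2 * l + j) ∸ 2 ^ (2 * l + j ∸ 2 * l)
    ≡⟨ cong₂ (λ a b → 2 ^ a ∸ 2 ^ b) (cong suc (+-comm (2 * l) j)) (m+n∸m≡n (2 * l) j) ⟩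
  2 ^ (suc j + 2 * l) ∸ 2 ^ j
    ≡⟨ cong₂ _∸_ (trans (cong (2 ^_) (sym (+-suc j (2 * l)))) (^-distribˡ-+-* 2 j (suc (2 * l))))
                 (sym (*-identityʳ (2 ^ j))) ⟩
  2 ^ j * 2 ^ suc (2 * l) ∸ 2 ^ j * 1
    ≡⟨ sym (*-distribˡ-∸ (2 ^ j) (2 ^ suc (2 * l)) 1) ⟩
  2 ^ j * q l ∎
  where open ≡-Reasoning

M-below : ∀ l i → i < 2 * l → suc (M l i) ≡ 2 ^ suc i
M-below l zero    _     = refl
M-below l (suc i) below = begin
  suc (m l i + M l i)     ≡⟨ sym (+-suc (m l i) (M l i)) ⟩
  m l i + suc (M l i)     ≡⟨ cong₂ _+_ (m-below l i below) (M-below l i (<⇒≤ below)) ⟩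
  2 ^ suc i + 2 ^ suc i   ≡⟨ cong (2 ^ suc i +_) (sym (+-identityʳ (2 ^ suc i))) ⟩
  2 ^ suc (suc i)         ∎
  where open ≡-Reasoning

M-at : ∀ l i → suc i ≡ 2 * l → M l i ≡ p l
M-at l i at = cong (_∸ 1) (trans (M-below l i (≤-reflexive at)) (cong (2 ^_) at))

M-beyond : ∀ k j → suc (M (suc k) (2 * suc k + j)) ≡ 2 ^ j * q (suc k)
M-beyond k zero = begin
  suc (M l (2 * l + 0))    ≡⟨ cong (λ i → suc (M l i)) (+-identityʳ (2 * l)) ⟩
  suc (m l i + M l i)      ≡⟨ cong suc (cong₂ _+_ (m-at l i refl) (M-at l i refl)) ⟩
  suc (p l + p l)          ≡⟨ sym (q≡1+2p l) ⟩
  q l                      ≡⟨ sym (+-identityʳ (q l)) ⟩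
  1 * q l                  ∎
  where
  open ≡-Reasoning
  l i : ℕ
  l = suc k
  i = k + suc (k + 0)  -- the critical index 2l - 1
M-beyond k (suc j) = begin
  suc (M l (2 * l + suc j))                   ≡⟨ cong (λ i → suc (M l i)) (+-suc (2 * l) j) ⟩
  suc (m l (2 * l + j) + M l (2 * l + j))     ≡⟨ sym (+-suc (m l (2 * l + j)) _) ⟩
  m l (2 * l + j) + suc (M l (2 * l + j))     ≡⟨ cong₂ _+_ (m-beyond l j) (M-beyond k j) ⟩
  2 ^ j * q l + 2 ^ j * q l                   ≡⟨ double (2 ^ j) (q l) ⟩
  2 ^ suc j * q l                             ∎
  where
  open ≡-Reasoning
  l : ℕ
  l = suc k
  double : ∀ a b → a * b + a * b ≡ 2 * a * b
  double = solve-∀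

multiple-bound : ∀ {a b} c t → a < b → c * b ≤ a + t * b → c ≤ t
multiple-bound {a} {b} c t a<b cb≤ = ≮⇒≥ λ t<c →
  <⇒≱ (≤-trans (+-monoˡ-< (t * b) a<b) (*-monoˡ-≤ b t<c)) cb≤

module Structure (k : ℕ) where

  l : ℕ
  l = suc k

  m-gap : ∀ i → suc i ≢ 2 * l → m l i ≡ suc (M l i)
  m-gap i ¬at with <-cmp (suc i) (2 * l)
  ... | tri< below _ _ = trans (m-below l i below) (sym (M-below l i (<⇒≤ below)))
  ... | tri≈ _ at _    = ⊥-elim (¬at at)
  ... | tri> _ _ (s≤s beyond) with m≤n⇒∃[o]m+o≡n beyond
  ...   | j , refl = trans (m-beyond l j) (sym (M-beyond k j))

  m-critical : ∀ i → suc i ≡ 2 * l → m l i ≡ M l i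
  m-critical i at = trans (m-at l i at) (sym (M-at l i at))

  M≤m : ∀ i → M l i ≤ m l i
  M≤m i with suc i ≟ 2 * l
  ... | yes at = ≤-reflexive (sym (m-critical i at))
  ... | no ¬at = subst (M l i ≤_) (sym (m-gap i ¬at)) (n≤1+n (M l i))

  m≤1+M : ∀ i → m l i ≤ suc (M l i)
  m≤1+M i with suc i ≟ 2 * l
  ... | yes at = subst (_≤ suc (M l i)) (sym (m-critical i at)) (n≤1+n (M l i))
  ... | no ¬at = ≤-reflexive (m-gap i ¬at)

  m-multiple : ∀ {i} → 2 * l ≤ i → ∃ λ c → m l i ≡ c * q l
  m-multiple le with m≤n⇒∃[o]m+o≡n le
  ... | j , refl = 2 ^ j , m-beyond l j

  M-grows : ∀ i → suc i ≤ M l i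
  M-grows zero    = s≤s z≤n
  M-grows (suc i) = ≤-trans (s≤s (M-grows i)) (+-monoˡ-≤ (M l i) (≤-trans (M-pos i) (M≤m i)))
    where
    M-pos : ∀ i → 1 ≤ M l i
    M-pos i = ≤-trans (s≤s z≤n) (M-grows i)

  low-shift : ∀ i y → m l i + y ≤ M l i → suc i ≡ 2 * l × y ≡ 0
  low-shift i y le with suc i ≟ 2 * l
  ... | no ¬at = ⊥-elim (<-irrefl refl (≤-trans (subst (_≤ m l i + y) (m-gap i ¬at) (m≤m+n _ y)) le))
  ... | yes at = at , no-excess y (subst (λ c → c + y ≤ M l i) (m-critical i at) le)
    where
    no-excess : ∀ y → M l i + y ≤ M l i → y ≡ 0
    no-excess zero    _  = refl
    no-excess (suc y) le′ = ⊥-elim (m+1+n≰m (M l i) le′)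

  X : Bool → ℕ → List ℕ
  X true  i = Aₛ l i
  X false i = Bₛ l i

  X-suc : ∀ s i → X s (suc i) ≡ X s i ++ map (m l i +_) (X (not s) i)
  X-suc true  i = refl
  X-suc false i = refl

  In : Bool → ℕ → Set
  In s x = ∃ λ i → x ∈ X s i

  old : ∀ s i {x} → x ∈ X s i → x ∈ X s (suc i)
  old s i h = subst (_ ∈_) (sym (X-suc s i)) (∈-++⁺ˡ h)

  new : ∀ s i {y} → y ∈ X (not s) i → m l i + y ∈ X s (suc i)
  new s i h = subst (_ ∈_) (sym (X-suc s i)) (∈-++⁺ʳ (X s i) (∈-map⁺ (m l i +_) h))

  split : ∀ s i {x} → x ∈ X s (suc i) → x ∈ X s i ⊎ ∃ λ y → y ∈ X (not s) i × x ≡ m l i + y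
  split s i h with ∈-++⁻ (X s i) (subst (_ ∈_) (X-suc s i) h)
  ... | inj₁ h′ = inj₁ h′
  ... | inj₂ h′ = inj₂ (∈-map⁻ (m l i +_) h′)

  lift : ∀ s {i x} j → i ≤ j → x ∈ X s i → x ∈ X s j
  lift s zero    z≤n h = h
  lift s (suc j) le  h with m≤n⇒m<n∨m≡n le
  ... | inj₁ (s≤s i≤j) = old s j (lift s j i≤j h)
  ... | inj₂ refl      = h

  bound : ∀ s i {x} → x ∈ X s i → x ≤ M l i
  bound true  zero (here refl) = z≤n
  bound false zero (here refl) = s≤s z≤n
  bound s (suc i) h with split s i h
  ... | inj₁ h′               = ≤-trans (bound s i h′) (M-step l i)
  ... | inj₂ (y , y∈ , refl) = +-monoʳ-≤ (m l i) (bound (not s) i y∈)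

  B-positive : ∀ i {x} → x ∈ X false i → 1 ≤ x
  B-positive zero    (here refl) = s≤s z≤n
  B-positive (suc i) h with split false i h
  ... | inj₁ h′             = B-positive i h′
  ... | inj₂ (y , _ , refl) = ≤-trans (≤-trans (s≤s z≤n) (M-grows i)) (≤-trans (M≤m i) (m≤m+n _ y))

  B-shift-above : ∀ i {y} → y ∈ X false i → M l i < m l i + y
  B-shift-above i {y} y∈ = ≰⇒> λ le →
    1+n≰n (subst (1 ≤_) (proj₂ (low-shift i y le)) (B-positive i y∈))

  0∈A : ∀ i → 0 ∈ X true i
  0∈A zero    = here refl
  0∈A (suc i) = old true i (0∈A i)

  top : ∀ j → M l (j + j) ∈ X false (j + j) × M l (suc (j + j)) ∈ X true (suc (j + j))
  top zero    = here refl , new true 0 (here refl)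
  top (suc j) = in-B , new true (suc j + suc j) in-B
    where
    in-B : M l (suc j + suc j) ∈ X false (suc j + suc j)
    in-B = subst (λ i → M l i ∈ X false i) (sym (+-suc (suc j) j)) (new false (suc (j + j)) (proj₂ (top j)))

  top-critical : ∀ i → suc i ≡ 2 * l → M l i ∈ X true i
  top-critical i at = subst (λ i → M l i ∈ X true i) (sym i≡) (proj₂ (top k))
    where
    2l≡ : ∀ k → 2 * suc k ≡ suc (suc (k + k))
    2l≡ = solve-∀
    i≡ : i ≡ suc (k + k)
    i≡ = suc-injective (trans at (2l≡ k))

  Meet : ℕ → ℕ → Set
  Meet i x = 2 * l ≤ i × (∃ λ t → x ≡ p l + t * q l) × x ≤ M l i

  meet-step : ∀ i {x} → Meet i x → Meet (suc i) x
  meet-step i (le , form , x≤) = m≤n⇒m≤1+n le , form , ≤-trans x≤ (M-step l i)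

  -- Shifting by m_i (a multiple of q beyond the critical index) preserves the progression.
  meet-shift : ∀ i {y} → Meet i y → Meet (suc i) (m l i + y)
  meet-shift i (le , (t , refl) , y≤) with m-multiple le
  ... | c , mc = m≤n⇒m≤1+n le , (c + t , shifted) , +-monoʳ-≤ (m l i) y≤
    where
    regroup : ∀ c t a b → c * b + (a + t * b) ≡ a + (c + t) * b
    regroup = solve-∀
    shifted : m l i + (p l + t * q l) ≡ p l + (c + t) * q l
    shifted = trans (cong (_+ (p l + t * q l)) mc) (regroup c t (p l) (q l))

  meet-critical : ∀ i → suc i ≡ 2 * l → Meet (suc i) (m l i + 0)
  meet-critical i at = ≤-reflexive (sym at) , (0 , p≡) , +-monoʳ-≤ (m l i) z≤n
    where
    p≡ : m l i + 0 ≡ p l + 0 * q l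
    p≡ = cong (_+ 0) (m-at l i at)

  meet-sound : ∀ i {x} → x ∈ X true i → x ∈ X false i → Meet i x
  meet-sound zero (here refl) (here ())
  meet-sound (suc i) {x} a b = cases (split true i a) (split false i b)
    where
    cases : x ∈ X true i ⊎ (∃ λ y → y ∈ X false i × x ≡ m l i + y) →
            x ∈ X false i ⊎ (∃ λ y → y ∈ X true i × x ≡ m l i + y) → Meet (suc i) x
    cases (inj₁ a′) (inj₁ b′) = meet-step i (meet-sound i a′ b′)
    cases (inj₁ a′) (inj₂ (y , _ , refl)) with low-shift i y (bound true i a′)
    ... | at , refl = meet-critical i at
    cases (inj₂ (y , y∈ , refl)) (inj₁ b′) = ⊥-elim (<⇒≱ (B-shift-above i y∈) (bound false i b′))
    cases (inj₂ (y , y∈ , refl)) (inj₂ (z , z∈ , eq)) =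
      meet-shift i (meet-sound i (subst (_∈ X true i) (sym (+-cancelˡ-≡ (m l i) y z eq)) z∈) y∈)

  disjoint-early : ∀ i {x} → suc i ≡ 2 * l → x ∈ X true i → x ∈ X false i → ⊥
  disjoint-early i at a b = 1+n≰n (≤-trans (≤-reflexive at) (proj₁ (meet-sound i a b)))

  separated : ∀ s i → Separated (m l i) (X s i) (X (not s) i)
  separated true  i x x∈ y y∈ refl = <⇒≱ (B-shift-above i y∈) (bound true i x∈)
  separated false i x x∈ y y∈ refl with low-shift i y (bound false i x∈)
  ... | at , refl = disjoint-early i at (top-critical i at) (subst (_∈ X false i) top≡ x∈)
    where
    top≡ : m l i + 0 ≡ M l i
    top≡ = trans (+-identityʳ (m l i)) (m-critical i at)

  unique : ∀ s i → Unique (X s i)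
  unique true  zero    = [] ∷ []
  unique false zero    = [] ∷ []
  unique s     (suc i) = subst Unique (sym (X-suc s i))
    (Unique.++⁺ (unique s i) (Unique.map⁺ (+-cancelˡ-≡ (m l i) _ _) (unique (not s) i)) apart)
    where
    apart : ∀ {v} → ¬ (v ∈ X s i × v ∈ map (m l i +_) (X (not s) i))
    apart (v∈ , v∈shift) with ∈-map⁻ (m l i +_) v∈shift
    ... | y , y∈ , eq = separated s i _ v∈ y y∈ eq

  sameRep : ∀ i → SameRep (X true i) (X false i)
  sameRep zero    g = cong (_+ 0) (trans (cong (_+ 0) (*-zeroʳ (g 0))) (sym (cong (_+ 0) (*-zeroʳ (g 2)))))
  sameRep (suc i)   = sameRep-step (m l i) (X true i) (X false i) (separated true i) (separated false i) (sameRep i)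

  -- At the critical index the only term of the progression below M_(i+1) = 2p is p itself.
  meet-critical-only : ∀ i {x} → suc i ≡ 2 * l → Meet (suc i) x → x ≡ p l
  meet-critical-only i at (_ , (zero  , refl) , _)  = +-identityʳ (p l)
  meet-critical-only i at (_ , (suc t , refl) , x≤) =
    ⊥-elim (<⇒≱ (p<q l) (≤-trans (m≤m+n (q l) (t * q l)) (+-cancelˡ-≤ (p l) _ _ (≤-trans x≤ M≤2p))))
    where
    M≤2p : M l (suc i) ≤ p l + p l
    M≤2p = ≤-reflexive (cong₂ _+_ (m-at l i at) (M-at l i at))

  -- p enters both sides at stage 2l: as M_(2l-1) ∈ A_(2l-1), and as m_(2l-1) + 0 ∈ B_(2l).
  p-in-both : ∀ i → suc i ≡ 2 * l → p l ∈ X true (suc i) × p l ∈ X false (suc i)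
  p-in-both i at = old true i (subst (_∈ X true i) (M-at l i at) (top-critical i at))
                 , subst (_∈ X false (suc i)) p≡ (new false i (0∈A i))
    where
    p≡ : m l i + 0 ≡ p l
    p≡ = trans (+-identityʳ (m l i)) (m-at l i at)

  meet-peel : ∀ i {x} → 2 * l ≤ i → M l i < x → Meet (suc i) x → ∃ λ y → x ≡ m l i + y × Meet i y
  meet-peel i le M<x (_ , (t , refl) , x≤) = p l + t′ * q l , x≡ , le , (t′ , refl) , y≤
    where
    ¬at : suc i ≢ 2 * l
    ¬at at = 1+n≰n (≤-trans (≤-reflexive at) le)
    c : ℕ
    c = proj₁ (m-multiple le)
    cq≤x : c * q l ≤ p l + t * q l
    cq≤x = subst (_≤ p l + t * q l) (proj₂ (m-multiple le))
                 (subst (_≤ p l + t * q l) (sym (m-gap i ¬at)) M<x)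
    excess : ∃ λ t′ → c + t′ ≡ t
    excess = m≤n⇒∃[o]m+o≡n (multiple-bound c t (p<q l) cq≤x)
    t′ : ℕ
    t′ = proj₁ excess
    regroup : ∀ c t a b → a + (c + t) * b ≡ c * b + (a + t * b)
    regroup = solve-∀
    x≡ : p l + t * q l ≡ m l i + (p l + t′ * q l)
    x≡ = begin
      p l + t * q l              ≡⟨ cong (λ t → p l + t * q l) (sym (proj₂ excess)) ⟩
      p l + (c + t′) * q l       ≡⟨ regroup c t′ (p l) (q l) ⟩
      c * q l + (p l + t′ * q l) ≡⟨ cong (_+ (p l + t′ * q l)) (sym (proj₂ (m-multiple le))) ⟩
      m l i + (p l + t′ * q l)   ∎
      where open ≡-Reasoning
    y≤ : p l + t′ * q l ≤ M l i
    y≤ = +-cancelˡ-≤ (m l i) _ _ (subst (_≤ M l (suc i)) x≡ x≤)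

  meet-complete : ∀ i {x} → Meet i x → x ∈ X true i × x ∈ X false i
  meet-complete zero    (() , _)
  meet-complete (suc i) {x} mt@(le , form , _) with m≤n⇒m<n∨m≡n le
  ... | inj₂ at = subst (λ y → y ∈ X true (suc i) × y ∈ X false (suc i))
                        (sym (meet-critical-only i (sym at) mt)) (p-in-both i (sym at))
  ... | inj₁ (s≤s 2l≤i) with x ≤? M l i
  ...   | yes x≤M = Data.Product.map (old true i) (old false i) (meet-complete i (2l≤i , form , x≤M))
  ...   | no  x≰M with meet-peel i 2l≤i (≰⇒> x≰M) mt
  ...     | y , refl , my = new true i (proj₂ (meet-complete i my)) , new false i (proj₁ (meet-complete i my))

  cover : ∀ i {x} → x ≤ M l i → x ∈ X true i ⊎ x ∈ X false i
  cover zero    z≤n       = inj₁ (here refl)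
  cover zero    (s≤s z≤n) = inj₂ (here refl)
  cover (suc i) {x} x≤ with x ≤? M l i
  ... | yes x≤M = Data.Sum.map (old true i) (old false i) (cover i x≤M)
  ... | no  x≰M with m≤n⇒∃[o]m+o≡n (≤-trans (m≤1+M i) (≰⇒> x≰M))
  ...   | y , refl with cover i (+-cancelˡ-≤ (m l i) _ _ x≤)
  ...     | inj₁ y∈A = inj₂ (new false i y∈A)
  ...     | inj₂ y∈B = inj₁ (new true i y∈B)

  settle : ∀ s i j {x} → x ∈ X s j → x < M l i → x ∈ X s i
  settle s i zero    h x< = lift s i z≤n h
  settle s i (suc j) h x< with split s j h
  ... | inj₁ h′ = settle s i j h′ x<
  ... | inj₂ (y , _ , refl) with suc j ≤? i
  ...   | yes sj≤i = lift s i sj≤i h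
  ...   | no  sj≰i = ⊥-elim (<⇒≱ x< (≤-trans (M-mono l j (≤-pred (≰⇒> sj≰i))) (≤-trans (M≤m j) (m≤m+n _ y))))

  R-at : ∀ s n → R≡ (In s) n (pairSum (δ n) (X s n))
  R-at s n = R≡-list (In s) n (X s n) (unique s n) (λ _ a∈ → n , a∈)
    (λ a a≤n (j , a∈) → settle s n j a∈ (≤-trans (s≤s a≤n) (M-grows n)))

theorem1 : (l : ℕ) → 1 ≤ l →
    (∀ n → ∃ λ k → R≡ (InA l) n k × R≡ (InB l) n k)
    × (∀ n → InA l n ⊎ InB l n)
    × (∀ n → (InA l n × InB l n) ⇔ (∃ λ t → n ≡ (2 ^ (2 * l) ∸ 1) + t * (2 ^ suc (2 * l) ∸ 1)))
theorem1 zero    ()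
theorem1 (suc k) _ = same-representations , covering , intersection
  where
  open Structure k
  same-representations : ∀ n → ∃ λ c → R≡ (In true) n c × R≡ (In false) n c
  same-representations n =
    pairSum (δ n) (X true n) , R-at true n , subst (R≡ (In false) n) (sym (sameRep n (δ n))) (R-at false n)
  covering : ∀ n → In true n ⊎ In false n
  covering n = Data.Sum.map (n ,_) (n ,_) (cover n (<⇒≤ (M-grows n)))
  intersection : ∀ n → (In true n × In false n) ⇔ (∃ λ t → n ≡ p l + t * q l)
  intersection n = mk⇔ to from
    where
    to : In true n × In false n → ∃ λ t → n ≡ p l + t * q l
    to ((i , a) , (j , b)) = proj₁ (proj₂ (meet-sound (i + j) (lift true (i + j) (m≤m+n i j) a)
                                                               (lift false (i + j) (m≤n+m j i) b)))
    -- n is at most M_(2l+n), so it is caught by the stage 2l + n.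
    from : (∃ λ t → n ≡ p l + t * q l) → In true n × In false n
    from form = (2 * l + n , proj₁ both) , (2 * l + n , proj₂ both)
      where
      both : n ∈ X true (2 * l + n) × n ∈ X false (2 * l + n)
      both = meet-complete (2 * l + n)
        (m≤m+n (2 * l) n , form , ≤-trans (m≤n+m n (2 * l)) (<⇒≤ (M-grows (2 * l + n))))
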